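{- Let $G$ be a connected graph and let $H$ be a block of $G$. Then $\mathrm{srd}(H)\leq \mathrm{srd}(G)$.
   Context: All graphs are simple, finite and undirected. A block of a graph is a maximal connected subgraph containing no cut-vertex. An edge-coloring of $G$ is any map $c:E(G)\to[k]$ (adjacent edges may receive the same color). For distinct vertices $u,v$ of a connected graph $G$, a $u$-$v$-edge-cut is a set $F$ of edges such that $u$ and $v$ lie in different components of $G-F$; a minimum $u$-$v$-edge-cut is one of minimum size among these. A set of edges is rainbow if no two of its edges have the same color. An edge-colored connected graph is strong rainbow disconnected if for every two distinct vertices $u,v$ there is a $u$-$v$-edge-cut that is both rainbow and minimum; $\mathrm{srd}(G)$ is the smallest number of colors of an edge-coloring making $G$ strong rainbow disconnected. -}

module Defs where

open import Data.Nat using (ℕ; _≤_)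
open import Data.Fin using (Fin) renaming (_<_ to _<ᶠ_)
open import Data.Bool using (Bool; true; false)
open import Data.Product using (Σ; ∃; _×_; _,_; proj₁)
open import Data.Sum using (_⊎_)
open import Data.Unit using (⊤)
open import Data.List using (List; length; map)
open import Data.List.Relation.Unary.Any using (Any)
open import Data.List.Relation.Unary.Unique.Propositional using (Unique)
open import Relation.Binary.PropositionalEquality using (_≡_; _≢_)
open import Relation.Nullary using (¬_)

record Graph (n : ℕ) : Set where
  field
    V      : Fin n → Bool
    adj    : Fin n → Fin n → Bool
    sym    : ∀ u v → adj u v ≡ true → adj v u ≡ true
    irrefl : ∀ u → adj u u ≡ false
    adjV   : ∀ u v → adj u v ≡ true → V u ≡ true
open Graph public

data Walk {n : ℕ} (G : Graph n) (ok : Fin n → Fin n → Set) : Fin n → Fin n → Set where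
  here : ∀ {u} → V G u ≡ true → Walk G ok u u
  step : ∀ {u w v} → adj G u w ≡ true → ok u w → Walk G ok w v → Walk G ok u v

Connected : ∀ {n} → Graph n → Set
Connected {n} G =
  (Σ (Fin n) λ u → V G u ≡ true) ×
  (∀ u v → V G u ≡ true → V G v ≡ true → Walk G (λ _ _ → ⊤) u v)

-- v is a cut-vertex of G: some two vertices other than v are joined in G
-- but not in G - v.
CutVertex : ∀ {n} → Graph n → Fin n → Set
CutVertex {n} G v = V G v ≡ true × Σ (Fin n) λ x → Σ (Fin n) λ y →
  V G x ≡ true × V G y ≡ true × x ≢ v × y ≢ v ×
  Walk G (λ _ _ → ⊤) x y × ¬ Walk G (λ a b → a ≢ v × b ≢ v) x y

NoCutVertex : ∀ {n} → Graph n → Set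
NoCutVertex {n} G = ∀ (v : Fin n) → ¬ CutVertex G v

_⊆G_ : ∀ {n} → Graph n → Graph n → Set
H ⊆G G = (∀ u → V H u ≡ true → V G u ≡ true) ×
         (∀ u v → adj H u v ≡ true → adj G u v ≡ true)

IsBlock : ∀ {n} → Graph n → Graph n → Set
IsBlock {n} G H = H ⊆G G × Connected H × NoCutVertex H ×
  (∀ (H' : Graph n) → H ⊆G H' → H' ⊆G G → Connected H' → NoCutVertex H' → H' ⊆G H)

-- Edges of G: unordered pairs {u,v}, represented with u < v.
Edge : ∀ {n} → Graph n → Set
Edge {n} G = Σ (Fin n) λ u → Σ (Fin n) λ v → u <ᶠ v × adj G u v ≡ true

src tgt : ∀ {n} {G : Graph n} → Edge G → Fin n
src (u , _) = u
tgt (_ , v , _) = v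

InSet : ∀ {n} {G : Graph n} → List (Edge G) → Fin n → Fin n → Set
InSet {G = G} F x y = Any (λ e → (src {G = G} e ≡ x × tgt {G = G} e ≡ y) ⊎ (src {G = G} e ≡ y × tgt {G = G} e ≡ x)) F

-- F (a duplicate-free list, i.e. a set of edges) is a u-v-edge-cut
EdgeCut : ∀ {n} (G : Graph n) → Fin n → Fin n → List (Edge G) → Set
EdgeCut G u v F = Unique F × ¬ Walk G (λ x y → ¬ InSet {G = G} F x y) u v

MinEdgeCut : ∀ {n} (G : Graph n) → Fin n → Fin n → List (Edge G) → Set
MinEdgeCut G u v F = EdgeCut G u v F ×
  (∀ F' → EdgeCut G u v F' → length F ≤ length F')

Rainbow : ∀ {n k} {G : Graph n} → (Edge G → Fin k) → List (Edge G) → Set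
Rainbow c F = Unique (map c F)

StrongRainbowDisconnecting : ∀ {n k} (G : Graph n) → (Edge G → Fin k) → Set
StrongRainbowDisconnecting {n} G c = ∀ (u v : Fin n) → V G u ≡ true → V G v ≡ true → u ≢ v →
  Σ (List (Edge G)) λ F → MinEdgeCut G u v F × Rainbow {G = G} c F

HasSRDColoring : ∀ {n} → Graph n → ℕ → Set
HasSRDColoring G k = Σ (Edge G → Fin k) λ c → StrongRainbowDisconnecting G c

IsSrd : ∀ {n} → Graph n → ℕ → Set
IsSrd G k = HasSRDColoring G k × (∀ j → HasSRDColoring G j → k ≤ j)

-- Restricting a strong rainbow disconnecting colouring of G to the block H
-- keeps it strong rainbow disconnecting. For u, v in H, intersecting a
-- rainbow minimum u-v-cut F of G with E(H) gives a rainbow u-v-cut of H,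
-- and it is minimum because every u-v-cut F' of H is also a u-v-cut of G:
-- a u-v-path of G avoiding F' would, together with H, form a connected
-- graph without cut-vertex, so by maximality of the block it runs inside H.
module Submission where

open import Defs
open import Data.Nat using (ℕ; _≤_)
open import Data.Nat.Properties using (<-irrelevant; module ≤-Reasoning)
open import Data.Fin using (Fin; _≟_) renaming (_<_ to _<ᶠ_)
open import Data.Bool using (Bool; true; false; _∨_; _∧_)
import Data.Bool as Bool
open import Data.Bool.Properties using (∧-zeroʳ)
open import Data.Product using (Σ; _×_; _,_; proj₁; proj₂)
open import Data.Sum using (_⊎_; inj₁; inj₂; [_,_])
open import Data.Unit using (⊤)
open import Data.List using (List; []; _∷_; length; map)
open import Data.List.Properties using (length-map; map-∘)
open import Data.List.Membership.Propositional using (_∈_)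
open import Data.List.Relation.Unary.Any using (here; there)
import Data.List.Relation.Unary.Any.Properties as Any
open import Data.List.Relation.Unary.All using (All; []; _∷_)
import Data.List.Relation.Unary.All as All
open import Data.List.Relation.Unary.All.Properties using (¬Any⇒All¬)
open import Data.List.Relation.Unary.AllPairs using ([]; _∷_)
open import Data.List.Relation.Unary.Unique.Propositional using (Unique)
import Data.List.Relation.Unary.Unique.Propositional.Properties as Unique
open import Data.List.Relation.Binary.Sublist.Propositional using (_⊆_; _∷ʳ_)
import Data.List.Relation.Binary.Sublist.Propositional as Sublist
open import Data.List.Relation.Binary.Sublist.Propositional.Properties
  using (All-resp-⊆; length-mono-≤)
import Data.List.Relation.Binary.Sublist.Propositional.Properties as Sublistₚ
open import Function using (_∘_)
open import Relation.Nullary using (¬_; Dec; yes; no; does; contradiction)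
open import Relation.Nullary.Decidable using (dec-true)
open import Relation.Binary.PropositionalEquality
  using (_≡_; _≢_; ≢-sym; refl; trans; cong; subst)
import Relation.Binary.PropositionalEquality as ≡
open import Axiom.UniquenessOfIdentityProofs using (module Decidable⇒UIP)

∨-true⁻ : ∀ {p q} → p ∨ q ≡ true → p ≡ true ⊎ q ≡ true
∨-true⁻ {true}  _ = inj₁ refl
∨-true⁻ {false} e = inj₂ e

∨-trueˡ : ∀ {p q} → p ≡ true → p ∨ q ≡ true
∨-trueˡ refl = refl

∨-trueʳ : ∀ {p q} → q ≡ true → p ∨ q ≡ true
∨-trueʳ {true}  _ = refl
∨-trueʳ {false} e = e

∨-map : ∀ {p q r s} → (p ≡ true → r ≡ true) → (q ≡ true → s ≡ true) →
        p ∨ q ≡ true → r ∨ s ≡ true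
∨-map f g = [ ∨-trueˡ ∘ f , ∨-trueʳ ∘ g ] ∘ ∨-true⁻

∧-true⁻ : ∀ p {q} → p ∧ q ≡ true → p ≡ true × q ≡ true
∧-true⁻ true e = refl , e

∧-true⁺ : ∀ {p q} → p ≡ true → q ≡ true → p ∧ q ≡ true
∧-true⁺ refl e = e

dec-true⁻ : {A : Set} (a? : Dec A) → does a? ≡ true → A
dec-true⁻ (yes a) _ = a

bool-uip : ∀ {p q : Bool} (e e′ : p ≡ q) → e ≡ e′
bool-uip = Decidable⇒UIP.≡-irrelevant Bool._≟_

Unique-resp-⊆ : {A : Set} {xs ys : List A} → xs ⊆ ys → Unique ys → Unique xs
Unique-resp-⊆ Sublist.[]             _        = []
Unique-resp-⊆ (_ ∷ʳ xs⊆ys)           (_ ∷ u)  = Unique-resp-⊆ xs⊆ys u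
Unique-resp-⊆ (refl Sublist.∷ xs⊆ys) (y∉ ∷ u) = All-resp-⊆ xs⊆ys y∉ ∷ Unique-resp-⊆ xs⊆ys u

module _ {n : ℕ} where

  open import Data.List.Membership.DecPropositional (_≟_ {n}) using (_∈?_)

  private
    variable
      k : ℕ
      G H K : Graph n
      ok ok' : Fin n → Fin n → Set
      a b u v w z : Fin n

  Avoiding : Fin n → Fin n → Fin n → Set
  Avoiding w x y = x ≢ w × y ≢ w

  vertices : Walk G ok a b → List (Fin n)
  vertices (here {u} _)     = u ∷ []
  vertices (step {u} _ _ W) = u ∷ vertices W

  IsPath : Walk G ok a b → Set
  IsPath W = Unique (vertices W)

  start-V : Walk G ok a b → V G a ≡ true
  start-V (here a∈G)               = a∈G
  start-V {G = G} (step {u} {w} e _ _) = adjV G u w e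

  start∈ : (W : Walk G ok a b) → a ∈ vertices W
  start∈ (here _)     = here refl
  start∈ (step _ _ _) = here refl

  end∈ : (W : Walk G ok a b) → b ∈ vertices W
  end∈ (here _)     = here refl
  end∈ (step _ _ W) = there (end∈ W)

  _++ʷ_ : Walk G ok a b → Walk G ok b v → Walk G ok a v
  here _     ++ʷ W′ = W′
  step e o W ++ʷ W′ = step e o (W ++ʷ W′)

  reverseʷ : (∀ {x y} → ok x y → ok y x) → Walk G ok a b → Walk G ok b a
  reverseʷ ok-sym (here a∈G) = here a∈G
  reverseʷ {G = G} ok-sym (step {u} {w} e o W) =
    reverseʷ ok-sym W ++ʷ step (Graph.sym G u w e) (ok-sym o) (here (adjV G u w e))

  mapʷ : H ⊆G K → (∀ {x y} → adj H x y ≡ true → ok x y → ok' x y) →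
         Walk H ok a b → Walk K ok' a b
  mapʷ (V⊆ , adj⊆) f (here a∈H)           = here (V⊆ _ a∈H)
  mapʷ (V⊆ , adj⊆) f (step {u} {w} e o W) = step (adj⊆ u w e) (f e o) (mapʷ (V⊆ , adj⊆) f W)

  connected-via : V G v ≡ true → (∀ x → V G x ≡ true → Walk G (λ _ _ → ⊤) x v) →
                  Connected G
  connected-via v∈G to-v =
    (_ , v∈G) , λ x y x∈G y∈G → to-v x x∈G ++ʷ reverseʷ _ (to-v y y∈G)

  suffix : (P : Walk G ok a b) → IsPath P → z ∈ vertices P → Σ (Walk G ok z b) IsPath
  suffix (here p)     P-path        (here refl) = here p , P-path
  suffix (step e o W) P-path        (here refl) = step e o W , P-path
  suffix (step e o W) (_ ∷ W-path) (there z∈W) = suffix W W-path z∈W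

  walk⇒path : Walk G ok a b → Σ (Walk G ok a b) IsPath
  walk⇒path (here p) = here p , [] ∷ []
  walk⇒path {a = a} (step e o W) with walk⇒path W
  ... | P , P-path with a ∈? vertices P
  ...   | yes a∈P = suffix P P-path a∈P
  ...   | no  a∉P = step e o P , ¬Any⇒All¬ _ a∉P ∷ P-path

  suffix-avoiding : (W : Walk G ok a b) → All (w ≢_) (vertices W) → z ∈ vertices W →
                    Walk G (Avoiding w) z b
  suffix-avoiding (here p) _ (here refl) = here p
  suffix-avoiding (step e _ W) (w≢u ∷ w∉W) (here refl) =
    step e (≢-sym w≢u , ≢-sym (All.lookup w∉W (start∈ W))) (suffix-avoiding W w∉W (start∈ W))
  suffix-avoiding (step _ _ W) (_ ∷ w∉W) (there z∈W) = suffix-avoiding W w∉W z∈W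

  -- Since a path meets w at most once, one of its two halves at z misses w.
  path-escapes : (P : Walk G ok a b) → IsPath P → z ∈ vertices P → z ≢ w →
                 (a ≢ w × Walk G (Avoiding w) z a) ⊎ (b ≢ w × Walk G (Avoiding w) z b)
  path-escapes (here p) _ (here refl) z≢w = inj₁ (z≢w , here p)
  path-escapes P@(step _ _ _) _ (here refl) z≢w = inj₁ (z≢w , here (start-V P))
  path-escapes {G = G} {w = w} (step {u} e o W) (u∉W ∷ W-path) (there z∈W) z≢w
    with path-escapes W W-path z∈W z≢w
  ... | inj₂ to-b = inj₂ to-b
  ... | inj₁ (w₀≢w , to-w₀) with u ≟ w
  ...   | no u≢w =
    inj₁ (u≢w , to-w₀ ++ʷ step (Graph.sym G u _ e) (w₀≢w , u≢w) (here (start-V (step e o W))))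
  ...   | yes refl =
    inj₂ (≢-sym (All.lookup u∉W (end∈ W)) , suffix-avoiding W u∉W z∈W)

  _∪ᴳ_ : Graph n → Graph n → Graph n
  H ∪ᴳ K = record
    { V      = λ x → V H x ∨ V K x
    ; adj    = λ x y → adj H x y ∨ adj K x y
    ; sym    = λ x y → ∨-map (Graph.sym H x y) (Graph.sym K x y)
    ; irrefl = λ x → trans (cong (_∨ adj K x x) (irrefl H x)) (irrefl K x)
    ; adjV   = λ x y → ∨-map (adjV H x y) (adjV K x y)
    }

  ⊆∪ˡ : (H K : Graph n) → H ⊆G (H ∪ᴳ K)
  ⊆∪ˡ _ _ = (λ _ → ∨-trueˡ) , (λ _ _ → ∨-trueˡ)

  ⊆∪ʳ : (H K : Graph n) → K ⊆G (H ∪ᴳ K)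
  ⊆∪ʳ _ _ = (λ _ → ∨-trueʳ) , (λ _ _ → ∨-trueʳ)

  ∪-least : {G H K : Graph n} → H ⊆G G → K ⊆G G → (H ∪ᴳ K) ⊆G G
  ∪-least (HV , Hadj) (KV , Kadj) =
    (λ x → [ HV x , KV x ] ∘ ∨-true⁻) , (λ x y → [ Hadj x y , Kadj x y ] ∘ ∨-true⁻)

  ⊆G-refl : H ⊆G H
  ⊆G-refl = (λ _ p → p) , (λ _ _ p → p)

  _[_] : Graph n → (Fin n → Bool) → Graph n
  G [ S ] = record
    { V      = λ x → S x ∧ V G x
    ; adj    = λ x y → (S x ∧ S y) ∧ adj G x y
    ; sym    = sym′
    ; irrefl = λ x → trans (cong ((S x ∧ S x) ∧_) (irrefl G x)) (∧-zeroʳ _)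
    ; adjV   = adjV′
    }
    where
    sym′ : ∀ x y → (S x ∧ S y) ∧ adj G x y ≡ true → (S y ∧ S x) ∧ adj G y x ≡ true
    sym′ x y e with ∧-true⁻ (S x ∧ S y) e
    ... | Sxy , xy with ∧-true⁻ (S x) Sxy
    ...   | Sx , Sy = ∧-true⁺ (∧-true⁺ Sy Sx) (Graph.sym G x y xy)
    adjV′ : ∀ x y → (S x ∧ S y) ∧ adj G x y ≡ true → S x ∧ V G x ≡ true
    adjV′ x y e with ∧-true⁻ (S x ∧ S y) e
    ... | Sxy , xy = ∧-true⁺ (proj₁ (∧-true⁻ (S x) Sxy)) (adjV G x y xy)

  induced-⊆ : (G : Graph n) (S : Fin n → Bool) → (G [ S ]) ⊆G G
  induced-⊆ G S = (λ x → proj₂ ∘ ∧-true⁻ (S x)) , (λ x y → proj₂ ∘ ∧-true⁻ (S x ∧ S y))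

  walk-induced : (S : Fin n → Bool) (W : Walk G ok a b) →
                 All (λ x → S x ≡ true) (vertices W) → Walk (G [ S ]) ok a b
  walk-induced S (here a∈G) (Sa ∷ _) = here (∧-true⁺ Sa a∈G)
  walk-induced S (step e o W) (Su ∷ S-W) =
    step (∧-true⁺ (∧-true⁺ Su (All.lookup S-W (start∈ W))) e) o (walk-induced S W S-W)

  vertices-induced : (S : Fin n → Bool) (W : Walk G ok a b)
                     (S-W : All (λ x → S x ≡ true) (vertices W)) →
                     vertices (walk-induced S W S-W) ≡ vertices W
  vertices-induced S (here _)     (_ ∷ _)    = refl
  vertices-induced S (step _ _ W) (_ ∷ S-W) = cong (_ ∷_) (vertices-induced S W S-W)

  no-cut-vertex⇒avoiding : Connected H → NoCutVertex H → V H u ≡ true → V H v ≡ true →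
                           u ≢ w → v ≢ w → ¬ ¬ Walk H (Avoiding w) u v
  no-cut-vertex⇒avoiding {H = H} {u = u} {v} {w} (_ , conn) no-cut u∈H v∈H u≢w v≢w no-walk
    with V H w in w∈H
  ... | true  = no-cut w (w∈H , u , v , u∈H , v∈H , u≢w , v≢w , conn u v u∈H v∈H , no-walk)
  ... | false = no-walk (mapʷ (⊆G-refl {H = H}) avoids (conn u v u∈H v∈H))
    where
    avoids : ∀ {x y} → adj H x y ≡ true → ⊤ → Avoiding w x y
    avoids {x} {y} e _ =
      (λ { refl → contradiction (trans (≡.sym (adjV H x y e)) w∈H) λ () }) ,
      (λ { refl → contradiction (trans (≡.sym (adjV H y x (Graph.sym H x y e))) w∈H) λ () })

  -- An ear of H: a graph K spanned by a path P with both ends in H.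
  module Ear (P : Walk K ok a b) (P-path : IsPath P)
             (spans : ∀ {x} → V K x ≡ true → x ∈ vertices P)
             (a∈H : V H a ≡ true) (b∈H : V H b ≡ true) where

    ear-connected : Connected H → Connected (H ∪ᴳ K)
    ear-connected (_ , conn) = connected-via (∨-trueˡ b∈H) to-b
      where
      to-b : ∀ x → V (H ∪ᴳ K) x ≡ true → Walk (H ∪ᴳ K) (λ _ _ → ⊤) x b
      to-b x x∈ with ∨-true⁻ x∈
      ... | inj₁ x∈H = mapʷ (⊆∪ˡ H K) _ (conn x b x∈H b∈H)
      ... | inj₂ x∈K = mapʷ (⊆∪ʳ H K) _ (proj₁ (suffix P P-path (spans x∈K)))

    escape-to-H : ∀ x → V (H ∪ᴳ K) x ≡ true → x ≢ w →
                  Σ (Fin _) λ h → V H h ≡ true × h ≢ w × Walk (H ∪ᴳ K) (Avoiding w) x h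
    escape-to-H x x∈ x≢w with ∨-true⁻ x∈
    ... | inj₁ x∈H = x , x∈H , x≢w , here (∨-trueˡ x∈H)
    ... | inj₂ x∈K with path-escapes P P-path (spans x∈K) x≢w
    ...   | inj₁ (a≢w , x→a) = a , a∈H , a≢w , mapʷ (⊆∪ʳ H K) (λ _ o → o) x→a
    ...   | inj₂ (b≢w , x→b) = b , b∈H , b≢w , mapʷ (⊆∪ʳ H K) (λ _ o → o) x→b

    ear-no-cut-vertex : Connected H → NoCutVertex H → NoCutVertex (H ∪ᴳ K)
    ear-no-cut-vertex connH no-cut w (_ , x , y , x∈ , y∈ , x≢w , y≢w , _ , no-walk)
      with escape-to-H x x∈ x≢w | escape-to-H y y∈ y≢w
    ... | h₁ , h₁∈H , h₁≢w , x→h₁ | h₂ , h₂∈H , h₂≢w , y→h₂ =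
      no-cut-vertex⇒avoiding connH no-cut h₁∈H h₂∈H h₁≢w h₂≢w λ h₁→h₂ →
        no-walk (x→h₁ ++ʷ (mapʷ (⊆∪ˡ H K) (λ _ o → o) h₁→h₂ ++ʷ reverseʷ (λ (p , q) → q , p) y→h₂))

  -- Quantifying over ok makes the rerouted walk use only edges of the original one.
  PathClosed : Graph n → Graph n → Set₁
  PathClosed G H = ∀ {ok : Fin n → Fin n → Set} {a b} →
    V H a ≡ true → V H b ≡ true → Walk G ok a b → Walk H ok a b

  block-path-closed : IsBlock G H → PathClosed G H
  block-path-closed {G = G} {H = H} (H⊆G , connH , no-cut , maximal) {ok} a∈H b∈H W
    with walk⇒path W
  ... | P , P-path = mapʷ H∪ear⊆H (λ _ o → o) Q′
    where
    span : Fin _ → Bool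
    span x = does (x ∈? vertices P)

    on-span : All (λ x → span x ≡ true) (vertices P)
    on-span = All.tabulate λ {x} → dec-true (x ∈? vertices P)

    ear : Graph _
    ear = G [ span ]

    Q : Walk ear ok _ _
    Q = walk-induced span P on-span

    Q-path : IsPath Q
    Q-path = subst Unique (≡.sym (vertices-induced span P on-span)) P-path

    spans : ∀ {x} → V ear x ≡ true → x ∈ vertices Q
    spans {x} x∈ear = subst (x ∈_) (≡.sym (vertices-induced span P on-span))
      (dec-true⁻ (x ∈? vertices P) (proj₁ (∧-true⁻ (span x) x∈ear)))

    Q′ : Walk (H ∪ᴳ ear) ok _ _
    Q′ = mapʷ (⊆∪ʳ H ear) (λ _ o → o) Q

    open Ear Q Q-path spans a∈H b∈H

    H∪ear⊆H : (H ∪ᴳ ear) ⊆G H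
    H∪ear⊆H = maximal (H ∪ᴳ ear) (⊆∪ˡ H ear) (∪-least {G} {H} {ear} H⊆G (induced-⊆ G span))
                      (ear-connected connH) (ear-no-cut-vertex connH no-cut)

  module Restriction (G H : Graph n) (H⊆G : H ⊆G G) where

    ⊆-edge : Edge H → Edge G
    ⊆-edge (x , y , x<y , e) = x , y , x<y , proj₂ H⊆G x y e

    ⊆-edge-injective : ∀ {e e′} → ⊆-edge e ≡ ⊆-edge e′ → e ≡ e′
    ⊆-edge-injective {x , y , x<y , e} {x′ , y′ , x<y′ , e′} eq
      with cong (λ (f : Edge G) → proj₁ f) eq | cong (λ (f : Edge G) → proj₁ (proj₂ f)) eq
    ... | refl | refl rewrite <-irrelevant x<y x<y′ | bool-uip e e′ = refl

    cons-if-adj : {x y : Fin n} → x <ᶠ y → (p : Bool) → adj H x y ≡ p →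
                  List (Edge H) → List (Edge H)
    cons-if-adj x<y true  xy∈H F = (_ , _ , x<y , xy∈H) ∷ F
    cons-if-adj x<y false _    F = F

    restrict : List (Edge G) → List (Edge H)
    restrict [] = []
    restrict ((x , y , x<y , _) ∷ F) = cons-if-adj x<y (adj H x y) refl (restrict F)

    restrict-⊆ : (F : List (Edge G)) → map ⊆-edge (restrict F) ⊆ F
    restrict-⊆ [] = Sublist.[]
    restrict-⊆ ((x , y , x<y , xy∈G) ∷ F) = cons-⊆ (adj H x y) refl
      where
      cons-⊆ : ∀ p (e : adj H x y ≡ p) →
               map ⊆-edge (cons-if-adj x<y p e (restrict F)) ⊆ (x , y , x<y , xy∈G) ∷ F
      cons-⊆ true  e = cong (λ q → x , y , x<y , q) (bool-uip _ xy∈G) Sublist.∷ restrict-⊆ F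
      cons-⊆ false _ = _ ∷ʳ restrict-⊆ F

    length-restrict : (F : List (Edge G)) → length (restrict F) ≤ length F
    length-restrict F = subst (_≤ length F) (length-map ⊆-edge (restrict F))
                              (length-mono-≤ (restrict-⊆ F))

    restrict-InSet : (F : List (Edge G)) → ∀ {x y} → InSet {G = G} F x y → adj H x y ≡ true →
                     InSet {G = H} (restrict F) x y
    restrict-InSet ((x′ , y′ , x<y′ , x′y′∈G) ∷ F) {x} {y} x∈F xy∈H =
      cons-InSet (adj H x′ y′) refl x∈F
      where
      cons-InSet : ∀ p (e : adj H x′ y′ ≡ p) → InSet {G = G} ((x′ , y′ , x<y′ , x′y′∈G) ∷ F) x y →
                   InSet {G = H} (cons-if-adj x<y′ p e (restrict F)) x y
      cons-InSet true  _ (here ends)  = here ends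
      cons-InSet true  _ (there x∈F′) = there (restrict-InSet F x∈F′ xy∈H)
      cons-InSet false _ (there x∈F′) = restrict-InSet F x∈F′ xy∈H
      cons-InSet false e (here (inj₁ (refl , refl))) = contradiction (trans (≡.sym xy∈H) e) λ ()
      cons-InSet false e (here (inj₂ (refl , refl))) =
        contradiction (trans (≡.sym (Graph.sym H _ _ xy∈H)) e) λ ()

    restrict-Rainbow : (c : Edge G → Fin k) (F : List (Edge G)) →
                       Rainbow {G = G} c F → Rainbow {G = H} (c ∘ ⊆-edge) (restrict F)
    restrict-Rainbow c F rainbow = subst Unique (≡.sym (map-∘ (restrict F)))
      (Unique-resp-⊆ (Sublistₚ.map⁺ c (restrict-⊆ F)) rainbow)

    restrict-EdgeCut : ∀ F → EdgeCut G u v F → EdgeCut H u v (restrict F)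
    restrict-EdgeCut F (F-unique , F-cuts) =
      Unique.map⁻ (Unique-resp-⊆ (restrict-⊆ F) F-unique) ,
      λ W → F-cuts (mapʷ H⊆G (λ xy∈H ∉F x∈F → ∉F (restrict-InSet F x∈F xy∈H)) W)

    module _ (closed : PathClosed G H) where

      ⊆-edge-EdgeCut : V H u ≡ true → V H v ≡ true →
                       ∀ F → EdgeCut H u v F → EdgeCut G u v (map ⊆-edge F)
      ⊆-edge-EdgeCut u∈H v∈H F (F-unique , F-cuts) =
        Unique.map⁺ ⊆-edge-injective F-unique ,
        λ W → F-cuts (closed u∈H v∈H (mapʷ (⊆G-refl {H = G}) (λ _ ∉F → ∉F ∘ Any.map⁺) W))

      restrict-MinEdgeCut : V H u ≡ true → V H v ≡ true →
                            ∀ F → MinEdgeCut G u v F → MinEdgeCut H u v (restrict F)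
      restrict-MinEdgeCut u∈H v∈H F (F-cut , F-min) = restrict-EdgeCut F F-cut , λ F′ F′-cut →
        begin
          length (restrict F)    ≤⟨ length-restrict F ⟩
          length F               ≤⟨ F-min _ (⊆-edge-EdgeCut u∈H v∈H F′ F′-cut) ⟩
          length (map ⊆-edge F′) ≡⟨ length-map ⊆-edge F′ ⟩
          length F′              ∎
        where open ≤-Reasoning

      restrict-srd : HasSRDColoring G k → HasSRDColoring H k
      restrict-srd (c , srd) = c ∘ ⊆-edge , srd-H
        where
        srd-H : StrongRainbowDisconnecting H (c ∘ ⊆-edge)
        srd-H u v u∈H v∈H u≢v with srd u v (proj₁ H⊆G u u∈H) (proj₁ H⊆G v v∈H) u≢v
        ... | F , F-min , F-rainbow =
          restrict F , restrict-MinEdgeCut u∈H v∈H F F-min , restrict-Rainbow c F F-rainbow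

lemma2p11 : ∀ {n} (G : Graph n) → Connected G → (H : Graph n) → IsBlock G H →
    ∀ (k m : ℕ) → IsSrd G k → IsSrd H m → m ≤ k
lemma2p11 G _ H H-block k m (G-colouring , _) (_ , m-least) =
  m-least k (Restriction.restrict-srd G H (proj₁ H-block) (block-path-closed H-block) G-colouring)
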